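{- Let $G$ be a graph and $H$ a graph admitting a barbell partition. Then both the Cartesian product $G\,\Box\, H$ and the tensor product $G\times H$ admit barbell partitions.
   Context: All graphs are finite and simple. $G\,\Box\,H$ has vertex set $V(G)\times V(H)$, with $(g_1,h_1)(g_2,h_2)$ an edge iff either $g_1=g_2$ and $h_1h_2\in E(H)$, or $h_1=h_2$ and $g_1g_2\in E(G)$. $G\times H$ has vertex set $V(G)\times V(H)$, with $(g_1,h_1)(g_2,h_2)$ an edge iff $g_1g_2\in E(G)$ and $h_1h_2\in E(H)$. A barbell partition of a graph $K$ is a partition of $V(K)$ into three disjoint sets $\{R,W_1,W_2\}$ with $W_1,W_2\neq\emptyset$ ($R$ may be empty), no edges between $W_1$ and $W_2$, and $|N_K(r)\cap W_i|\neq 1$ for all $r\in R$, $i\in\{1,2\}$. -}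

module Defs where

open import Data.Nat using (ℕ; _*_)
open import Data.Fin using (Fin)
open import Data.Fin.Properties using (*↔×) renaming (_≟_ to _≟F_)
open import Data.Product using (_×_; _,_; ∃; ∃-syntax; Σ; proj₁; proj₂)
open import Data.Product.Function.NonDependent.Propositional using (_×-↔_)
open import Data.Sum using (_⊎_; inj₁; inj₂)
open import Relation.Nullary using (¬_; Dec; yes; no)
open import Relation.Nullary.Decidable using (_×-dec_; _⊎-dec_)
open import Relation.Binary.PropositionalEquality as ≡ using (_≡_; refl; cong)
open import Function.Bundles using (_↔_; Inverse)
open import Function.Properties.Inverse using (↔-trans)

record Graph : Set₁ where
  field
    V      : Set
    size   : ℕ
    finite : Fin size ↔ V
    Adj    : V → V → Set
    adj?   : (u v : V) → Dec (Adj u v)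
    adj-sym    : ∀ {u v} → Adj u v → Adj v u
    adj-irrefl : ∀ {v} → ¬ Adj v v
open Graph public

decEqFin : ∀ {A : Set} (n : ℕ) → Fin n ↔ A → (x y : A) → Dec (x ≡ y)
decEqFin n e x y with Inverse.from e x ≟F Inverse.from e y
... | yes q = yes (≡.trans (≡.sym (Inverse.strictlyInverseˡ e x))
                    (≡.trans (cong (Inverse.to e) q) (Inverse.strictlyInverseˡ e y)))
... | no q = no (λ x≡y → q (cong (Inverse.from e) x≡y))

_≟V_ : (K : Graph) → (x y : V K) → Dec (x ≡ y)
K ≟V x = decEqFin (size K) (finite K) x

prodFinite : (G H : Graph) → Fin (size G * size H) ↔ (V G × V H)
prodFinite G H = ↔-trans *↔× (finite G ×-↔ finite H)

_□_ : Graph → Graph → Graph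
G □ H = record
  { V = V G × V H
  ; size = size G * size H
  ; finite = prodFinite G H
  ; Adj = λ { (g₁ , h₁) (g₂ , h₂) →
              (g₁ ≡ g₂ × Adj H h₁ h₂) ⊎ (h₁ ≡ h₂ × Adj G g₁ g₂) }
  ; adj? = λ { (g₁ , h₁) (g₂ , h₂) →
              ((G ≟V g₁) g₂ ×-dec adj? H h₁ h₂) ⊎-dec ((H ≟V h₁) h₂ ×-dec adj? G g₁ g₂) }
  ; adj-sym = λ { (inj₁ (e , a)) → inj₁ (≡.sym e , adj-sym H a)
                ; (inj₂ (e , a)) → inj₂ (≡.sym e , adj-sym G a) }
  ; adj-irrefl = λ { (inj₁ (_ , a)) → adj-irrefl H a
                   ; (inj₂ (_ , a)) → adj-irrefl G a }
  }

_⊗_ : Graph → Graph → Graph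
G ⊗ H = record
  { V = V G × V H
  ; size = size G * size H
  ; finite = prodFinite G H
  ; Adj = λ { (g₁ , h₁) (g₂ , h₂) → Adj G g₁ g₂ × Adj H h₁ h₂ }
  ; adj? = λ { (g₁ , h₁) (g₂ , h₂) → adj? G g₁ g₂ ×-dec adj? H h₁ h₂ }
  ; adj-sym = λ { (a , b) → adj-sym G a , adj-sym H b }
  ; adj-irrefl = λ { (a , _) → adj-irrefl G a }
  }

data Block : Set where
  R W₁ W₂ : Block

ExactlyOneNbrIn : (K : Graph) → (V K → Block) → V K → Block → Set
ExactlyOneNbrIn K p r b =
  ∃[ w ] (Adj K r w × p w ≡ b × (∀ w' → Adj K r w' → p w' ≡ b → w' ≡ w))

-- A barbell partition {R, W₁, W₂} of V(K), given by its block-assignment map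
-- (R = p⁻¹(R), W₁ = p⁻¹(W₁), W₂ = p⁻¹(W₂); R may be empty).
record IsBarbellPartition (K : Graph) (p : V K → Block) : Set where
  field
    W₁-nonempty  : ∃[ v ] (p v ≡ W₁)
    W₂-nonempty  : ∃[ v ] (p v ≡ W₂)
    no-W₁W₂-edge : ∀ u v → p u ≡ W₁ → p v ≡ W₂ → ¬ Adj K u v
    R-W₁ : ∀ r → p r ≡ R → ¬ ExactlyOneNbrIn K p r W₁
    R-W₂ : ∀ r → p r ≡ R → ¬ ExactlyOneNbrIn K p r W₂

HasBarbellPartition : Graph → Set
HasBarbellPartition K = Σ (V K → Block) (IsBarbellPartition K)

{-# OPTIONS --safe #-}
module Submission where

-- A barbell partition of H pulls back along the projection onto H, both for
-- G □ H and for G × H. All the pullback needs is that the projection sends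
-- edges to edges or collapses them, and that, at any vertex that has some
-- neighbour at all, every edge of H at the image lifts to an edge upstairs:
-- then "exactly one neighbour in Wᵢ" upstairs forces the same downstairs.

open import Defs
open import Data.Product using (_×_; _,_; ∃-syntax; proj₁; proj₂)
open import Data.Empty using (⊥-elim)
open import Data.Sum using (_⊎_; inj₁; inj₂)
open import Function using (_∘_)
open import Relation.Binary.PropositionalEquality
  using (_≡_; _≢_; refl; sym; trans; cong)
open import Relation.Nullary using (¬_)

record IsNeighbourhoodLifting (K H : Graph) (π : V K → V H) : Set where
  field
    surjective : ∀ h → ∃[ k ] (π k ≡ h)
    adj-weakly-preserved : ∀ {u v} → Adj K u v → π u ≡ π v ⊎ Adj H (π u) (π v)
    adj-lifted : ∀ {r k h} → Adj K r k → Adj H (π r) h → ∃[ k' ] (Adj K r k' × π k' ≡ h)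

module _ {K H : Graph} {π : V K → V H} (lift : IsNeighbourhoodLifting K H π)
         {p : V H → Block} (bp : IsBarbellPartition H p) where
  open IsNeighbourhoodLifting lift
  open IsBarbellPartition bp

  private
    preimage-in : ∀ {b} → ∃[ h ] (p h ≡ b) → ∃[ k ] (p (π k) ≡ b)
    preimage-in (h , ph) with surjective h
    ... | k , refl = k , ph

    exactlyOneNbr-pushforward : ∀ {r b} → p (π r) ≡ R → R ≢ b →
      ExactlyOneNbrIn K (p ∘ π) r b → ExactlyOneNbrIn H p (π r) b
    exactlyOneNbr-pushforward {r} {b} pr R≢b (w , r~w , pw , unique)
      with adj-weakly-preserved r~w
    ... | inj₁ πr≡πw = ⊥-elim (R≢b (trans (sym pr) (trans (cong p πr≡πw) pw)))
    ... | inj₂ πr~πw = π w , πr~πw , pw , unique-image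
      where
        unique-image : ∀ h → Adj H (π r) h → p h ≡ b → h ≡ π w
        unique-image h πr~h ph with adj-lifted r~w πr~h
        ... | k , r~k , refl = cong π (unique k r~k ph)

  pullbackBarbellPartition : IsBarbellPartition K (p ∘ π)
  pullbackBarbellPartition = record
    { W₁-nonempty  = preimage-in W₁-nonempty
    ; W₂-nonempty  = preimage-in W₂-nonempty
    ; no-W₁W₂-edge = no-edge
    ; R-W₁ = λ r pr → R-W₁ (π r) pr ∘ exactlyOneNbr-pushforward pr λ ()
    ; R-W₂ = λ r pr → R-W₂ (π r) pr ∘ exactlyOneNbr-pushforward pr λ ()
    }
    where
      no-edge : ∀ u v → p (π u) ≡ W₁ → p (π v) ≡ W₂ → ¬ Adj K u v
      no-edge u v pu pv u~v with adj-weakly-preserved u~v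
      ... | inj₁ πu≡πv with () ← trans (sym pu) (trans (cong p πu≡πv) pv)
      ... | inj₂ πu~πv = no-W₁W₂-edge (π u) (π v) pu pv πu~πv

□-projection : (G H : Graph) → V G → IsNeighbourhoodLifting (G □ H) H proj₂
□-projection G H g₀ = record
  { surjective = λ h → (g₀ , h) , refl
  ; adj-weakly-preserved = λ { (inj₁ (_ , h~h')) → inj₂ h~h'
                             ; (inj₂ (h≡h' , _)) → inj₁ h≡h' }
  ; adj-lifted = λ { {g , _} _ h~h' → (g , _) , inj₁ (refl , h~h') , refl }
  }

⊗-projection : (G H : Graph) → V G → IsNeighbourhoodLifting (G ⊗ H) H proj₂
⊗-projection G H g₀ = record
  { surjective = λ h → (g₀ , h) , refl
  ; adj-weakly-preserved = inj₂ ∘ proj₂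
  ; adj-lifted = λ { {k = g' , _} (g~g' , _) h~h' → (g' , _) , (g~g' , h~h') , refl }
  }

mainTheorem15 : (G H : Graph) → V G → HasBarbellPartition H →
    HasBarbellPartition (G □ H) × HasBarbellPartition (G ⊗ H)
mainTheorem15 G H g₀ (p , bp) =
    (p ∘ proj₂ , pullbackBarbellPartition (□-projection G H g₀) bp)
  , (p ∘ proj₂ , pullbackBarbellPartition (⊗-projection G H g₀) bp)
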